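{- Let $T$ be a binary tree. Then the projective toric variety $Y_T$ is not smooth.
   Context: A binary tree here is a rooted tree in which every non-leaf node has exactly two children. Let $T$ have $n$ nodes labeled $1,\dots,n$, with node $1$ the root, and write $\rho(j)$ for the parent of a non-root node $j$. For each $0/1$-labeling $(i_1,\dots,i_n)\in\{0,1\}^n$ of the nodes, let $\mathbf a_{i_1\dots i_n}\in\mathbb Z_{\ge 0}^4$ be the exponent vector, with respect to the ordered variables $(a_{00},a_{01},a_{10},a_{11})$, of the monomial $\prod_{j=2}^n a_{i_{\rho(j)} i_j}$. Equivalently, its coordinates count the edges of $T$ whose (parent label, child label) transition is $0\to0$, $0\to1$, $1\to0$, $1\to1$ respectively. The configuration $\mathcal A_T$ is the $4\times 2^n$ matrix with these columns. The toric ideal $I_T\subset\mathbb C[p_{i_1\dots i_n}]$ is the kernel of the ring map sending $p_{i_1\dots i_n}\mapsto\prod_{j=2}^n a_{i_{\rho(j)}i_j}$. It is homogeneous and defines the projective toric variety $Y_T$. This variety is covered by the affine toric varieties given by the configurations $\mathcal A_T-\mathbf a_{i}$, i.e. the columns of $\mathcal A_T$ translated by a fixed column $\mathbf a_i$. An affine toric variety given by a configuration $\mathcal B$ is called smooth if the semigroup $\mathbb N\mathcal B$ is isomorphic to $\mathbb N^r$ for some $r$. $Y_T$ is called smooth if all of these affine charts are smooth. -}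

module Defs where

open import Data.Bool using (Bool; true; false)
open import Data.Nat using (ℕ)
open import Data.Integer using (ℤ; +_; _-_) renaming (_+_ to _+ℤ_)
open import Data.Vec using (Vec; []; _∷_; zipWith; replicate)
open import Data.Product using (_×_; _,_; Σ; ∃)
open import Relation.Binary.PropositionalEquality using (_≡_)
open import Function.Definitions using (Injective)

data BTree : Set where
  leaf : BTree
  node : BTree → BTree → BTree

-- 0/1-labelings of the nodes of a tree (false = 0, true = 1).
Labeling : BTree → Set
Labeling leaf       = Bool
Labeling (node l r) = Bool × Labeling l × Labeling r

rootLabel : (t : BTree) → Labeling t → Bool
rootLabel leaf       b           = b
rootLabel (node l r) (b , _ , _) = b

-- Vectors in ℤ^4, coordinates ordered (a00, a01, a10, a11).
V4 : Set
V4 = Vec ℤ 4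

_⊕_ : V4 → V4 → V4
_⊕_ = zipWith _+ℤ_

_⊖_ : V4 → V4 → V4
_⊖_ = zipWith _-_

zero4 : V4
zero4 = replicate 4 (+ 0)

edgeVec : Bool → Bool → V4
edgeVec false false = + 1 ∷ + 0 ∷ + 0 ∷ + 0 ∷ []
edgeVec false true  = + 0 ∷ + 1 ∷ + 0 ∷ + 0 ∷ []
edgeVec true  false = + 0 ∷ + 0 ∷ + 1 ∷ + 0 ∷ []
edgeVec true  true  = + 0 ∷ + 0 ∷ + 0 ∷ + 1 ∷ []

expVec : (t : BTree) → Labeling t → V4
expVec leaf       _             = zero4
expVec (node l r) (b , il , ir) =
  (edgeVec b (rootLabel l il) ⊕ edgeVec b (rootLabel r ir)) ⊕ (expVec l il ⊕ expVec r ir)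

data InChartSemigroup (t : BTree) (i : Labeling t) : V4 → Set where
  sg-zero : InChartSemigroup t i zero4
  sg-add  : (j : Labeling t) {x : V4} → InChartSemigroup t i x →
            InChartSemigroup t i ((expVec t j ⊖ expVec t i) ⊕ x)

_+ᴺ_ : {r : ℕ} → Vec ℕ r → Vec ℕ r → Vec ℕ r
_+ᴺ_ = zipWith Data.Nat._+_

record FreeIso (t : BTree) (i : Labeling t) (r : ℕ) : Set where
  field
    f        : Vec ℕ r → V4
    into     : ∀ u → InChartSemigroup t i (f u)
    additive : ∀ u v → f (u +ᴺ v) ≡ f u ⊕ f v
    inj      : Injective _≡_ _≡_ f
    onto     : ∀ x → InChartSemigroup t i x → ∃ λ u → f u ≡ x

SmoothChart : (t : BTree) → Labeling t → Set
SmoothChart t i = Σ ℕ (FreeIso t i)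

SmoothY : BTree → Set
SmoothY t = (i : Labeling t) → SmoothChart t i

-- Work in the chart at the all-zero labelling o, whose column has a₁₀ = a₁₁ = 0.
-- Every node has zero or two children, so the edges leaving nodes labelled 1 come in
-- pairs: every column has a₁₀ + a₁₁ even, hence every element of the chart semigroup
-- is Balanced (a₁₀, a₁₁ ≥ 0 with even sum). Descending to a cherry of T and labelling
-- it 1|00, 1|11, 1|10 (all other nodes 0) gives columns with a_A + a_B = 2 a_C, where
-- (a₁₀, a₁₁) is (2, 0) for a_A and (1, 1) for a_C. A semigroup isomorphic to ℕ^r
-- inherits Riesz refinement from ℕ, which would split a_A − a_o = x₀₀ + x₀₁ and
-- a_C − a_o = x₀₀ + x₁₀ = x₀₁ + x₁₁ inside the semigroup; comparing coordinates then
-- forces (a₁₀, a₁₁) = (1, 0) for x₀₀, an odd sum.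

module Submission where

open import Defs
open import Relation.Nullary using (¬_)
open import Level using (0ℓ)
open import Algebra.Bundles using (CommutativeSemigroup; CommutativeMonoid)
import Algebra.Properties.CommutativeSemigroup as CommutativeSemigroupProperties
open import Data.Bool using (Bool; true; false)
open import Data.Empty using (⊥)
open import Data.Fin using (#_)
open import Data.Integer using (+_; -_; _-_) renaming (_+_ to _+ℤ_)
import Data.Integer.Properties as ℤ
open import Data.Nat using (ℕ; zero; suc; _+_; _≤_; z≤n; s≤s)
open import Data.Nat.Divisibility using (_∣_; divides; _∣0; ∣m∣n⇒∣m+n; ∣1⇒≡1)
open import Data.Nat.Properties using (+-commutativeSemigroup; suc-injective; m≤m+n; m+n≡0⇒m≡0)
open import Data.Product using (Σ; _×_; _,_; ∃₂; proj₁; proj₂)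
open import Data.Vec using (Vec; []; _∷_; lookup; map)
open import Data.Vec.Properties
  using ( zipWith-assoc; zipWith-comm; zipWith-identityˡ; zipWith-identityʳ; zipWith-map₂
        ; lookup-zipWith; ∷-injective)
open import Relation.Binary.PropositionalEquality
  using (_≡_; _≢_; refl; sym; trans; cong; cong₂; subst; isEquivalence)

module _ {c ℓ} (S : CommutativeSemigroup c ℓ) where
  open CommutativeSemigroup S
  open CommutativeSemigroupProperties S using (interchange)
  open import Relation.Binary.Reasoning.Setoid setoid

  midpoint-∙ : ∀ {x y w x′ y′ w′} → x ∙ y ≈ w ∙ w → x′ ∙ y′ ≈ w′ ∙ w′ →
               (x ∙ x′) ∙ (y ∙ y′) ≈ (w ∙ w′) ∙ (w ∙ w′)
  midpoint-∙ {x} {y} {w} {x′} {y′} {w′} e e′ = begin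
    (x ∙ x′) ∙ (y ∙ y′) ≈⟨ interchange x x′ y y′ ⟩
    (x ∙ y) ∙ (x′ ∙ y′) ≈⟨ ∙-cong e e′ ⟩
    (w ∙ w) ∙ (w′ ∙ w′) ≈⟨ interchange w w w′ w′ ⟩
    (w ∙ w′) ∙ (w ∙ w′) ∎

record Refinement {A : Set} (_∙_ : A → A → A) (a b c d : A) : Set where
  constructor refinement
  field
    x₀₀ x₀₁ x₁₀ x₁₁ : A
    a≡x₀₀∙x₀₁ : a ≡ x₀₀ ∙ x₀₁
    b≡x₁₀∙x₁₁ : b ≡ x₁₀ ∙ x₁₁
    c≡x₀₀∙x₁₀ : c ≡ x₀₀ ∙ x₁₀
    d≡x₀₁∙x₁₁ : d ≡ x₀₁ ∙ x₁₁

  All : (A → Set) → Set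
  All P = P x₀₀ × P x₀₁ × P x₁₀ × P x₁₁

  all-map : ∀ {P Q : A → Set} → (∀ {x} → P x → Q x) → All P → All Q
  all-map f (p₀₀ , p₀₁ , p₁₀ , p₁₁) = f p₀₀ , f p₀₁ , f p₁₀ , f p₁₁

refinement-map : ∀ {A B : Set} {_∙_ : A → A → A} {_∘_ : B → B → B} {a b c d}
                 (f : A → B) → (∀ u v → f (u ∙ v) ≡ f u ∘ f v) →
                 Refinement _∙_ a b c d → Refinement _∘_ (f a) (f b) (f c) (f d)
refinement-map {_∙_ = _∙_} {_∘_ = _∘_} f hom ρ = refinement (f x₀₀) (f x₀₁) (f x₁₀) (f x₁₁)
  (split a≡x₀₀∙x₀₁) (split b≡x₁₀∙x₁₁) (split c≡x₀₀∙x₁₀) (split d≡x₀₁∙x₁₁)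
  where
  open Refinement ρ
  split : ∀ {a u v} → a ≡ u ∙ v → f a ≡ f u ∘ f v
  split {u = u} {v} a≡u∙v = trans (cong f a≡u∙v) (hom u v)

+-refinement : ∀ a b c d → a + b ≡ c + d → Refinement _+_ a b c d
+-refinement zero    b c       d eq = refinement 0 0 c d refl eq refl refl
+-refinement (suc a) b zero    d eq = refinement 0 (suc a) 0 b refl refl refl (sym eq)
+-refinement (suc a) b (suc c) d eq with +-refinement a b c d (suc-injective eq)
... | refinement x₀₀ x₀₁ x₁₀ x₁₁ refl refl refl refl =
  refinement (suc x₀₀) x₀₁ x₁₀ x₁₁ refl refl refl refl

+ᴺ-refinement : ∀ {r} (a b c d : Vec ℕ r) → a +ᴺ b ≡ c +ᴺ d → Refinement _+ᴺ_ a b c d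
+ᴺ-refinement [] [] [] [] _ = refinement [] [] [] [] refl refl refl refl
+ᴺ-refinement (a ∷ as) (b ∷ bs) (c ∷ cs) (d ∷ ds) eq
  with ∷-injective eq
... | head≡ , tail≡
  with +-refinement a b c d head≡ | +ᴺ-refinement as bs cs ds tail≡
... | refinement x₀₀ x₀₁ x₁₀ x₁₁ refl refl refl refl
    | refinement xs₀₀ xs₀₁ xs₁₀ xs₁₁ refl refl refl refl =
  refinement (x₀₀ ∷ xs₀₀) (x₀₁ ∷ xs₀₁) (x₁₀ ∷ xs₁₀) (x₁₁ ∷ xs₁₁) refl refl refl refl

module _ {t : BTree} {i : Labeling t} {r : ℕ} (iso : FreeIso t i r) where
  open FreeIso iso

  chart-refinement : ∀ {x y w v} →
    InChartSemigroup t i x → InChartSemigroup t i y →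
    InChartSemigroup t i w → InChartSemigroup t i v → x ⊕ y ≡ w ⊕ v →
    Σ (Refinement _⊕_ x y w v) λ ρ → Refinement.All ρ (InChartSemigroup t i)
  chart-refinement x∈ y∈ w∈ v∈ eq
    with onto _ x∈ | onto _ y∈ | onto _ w∈ | onto _ v∈
  ... | ux , refl | uy , refl | uw , refl | uv , refl =
    refinement-map f additive ρ , into x₀₀ , into x₀₁ , into x₁₀ , into x₁₁
    where
    ρ = +ᴺ-refinement ux uy uw uv (inj (trans (additive ux uy) (trans eq (sym (additive uw uv)))))
    open Refinement ρ

⊕-commutativeMonoid : CommutativeMonoid 0ℓ 0ℓ
⊕-commutativeMonoid = record
  { Carrier = V4
  ; _≈_ = _≡_
  ; _∙_ = _⊕_
  ; ε = zero4
  ; isCommutativeMonoid = record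
    { isMonoid = record
      { isSemigroup = record
        { isMagma = record { isEquivalence = isEquivalence ; ∙-cong = cong₂ _⊕_ }
        ; assoc = zipWith-assoc ℤ.+-assoc
        }
      ; identity = zipWith-identityˡ ℤ.+-identityˡ , zipWith-identityʳ ℤ.+-identityʳ
      }
    ; comm = zipWith-comm ℤ.+-comm
    }
  }

open CommutativeMonoid ⊕-commutativeMonoid
  using (commutativeSemigroup) renaming (assoc to ⊕-assoc; identityʳ to ⊕-identityʳ)
open CommutativeSemigroupProperties commutativeSemigroup using (x∙yz≈xz∙y)

⊖-as-⊕ : ∀ x y → x ⊖ y ≡ x ⊕ map -_ y
⊖-as-⊕ x y = sym (zipWith-map₂ _+ℤ_ -_ x y)

midpoint-⊖ : ∀ {x y w} k → x ⊕ y ≡ w ⊕ w → (x ⊖ k) ⊕ (y ⊖ k) ≡ (w ⊖ k) ⊕ (w ⊖ k)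
midpoint-⊖ {x} {y} {w} k e
  rewrite ⊖-as-⊕ x k | ⊖-as-⊕ y k | ⊖-as-⊕ w k = midpoint-∙ commutativeSemigroup e refl

generator : ∀ t i j → InChartSemigroup t i (expVec t j ⊖ expVec t i)
generator t i j = subst (InChartSemigroup t i) (⊕-identityʳ _) (sg-add j sg-zero)

record HasOnes (x : V4) (m n : ℕ) : Set where
  constructor ones
  field
    a₁₀≡m : lookup x (# 2) ≡ + m
    a₁₁≡n : lookup x (# 3) ≡ + n

lookup-⊕ : ∀ i x y {m m′} → lookup x i ≡ + m → lookup y i ≡ + m′ → lookup (x ⊕ y) i ≡ + (m + m′)
lookup-⊕ i x y p q = trans (lookup-zipWith _+ℤ_ i x y) (cong₂ _+ℤ_ p q)

lookup-⊖ : ∀ i x y {m} → lookup x i ≡ + m → lookup y i ≡ + 0 → lookup (x ⊖ y) i ≡ + m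
lookup-⊖ i x y {m} p q =
  trans (lookup-zipWith _-_ i x y) (trans (cong₂ _-_ p q) (ℤ.+-identityʳ (+ m)))

hasOnes-⊕ : ∀ {x y m n m′ n′} → HasOnes x m n → HasOnes y m′ n′ → HasOnes (x ⊕ y) (m + m′) (n + n′)
hasOnes-⊕ {x} {y} (ones p q) (ones p′ q′) = ones (lookup-⊕ (# 2) x y p p′) (lookup-⊕ (# 3) x y q q′)

hasOnes-⊖ : ∀ {x y m n} → HasOnes x m n → HasOnes y 0 0 → HasOnes (x ⊖ y) m n
hasOnes-⊖ {x} {y} (ones p q) (ones p′ q′) = ones (lookup-⊖ (# 2) x y p p′) (lookup-⊖ (# 3) x y q q′)

hasOnes-unique : ∀ {x m n m′ n′} → HasOnes x m n → HasOnes x m′ n′ → m ≡ m′ × n ≡ n′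
hasOnes-unique (ones p q) (ones p′ q′) =
  ℤ.+-injective (trans (sym p) p′) , ℤ.+-injective (trans (sym q) q′)

hasOnes-edgeVec-false : ∀ c → HasOnes (edgeVec false c) 0 0
hasOnes-edgeVec-false false = ones refl refl
hasOnes-edgeVec-false true  = ones refl refl

zeroLabeling : (t : BTree) → Labeling t
zeroLabeling leaf       = false
zeroLabeling (node l r) = false , zeroLabeling l , zeroLabeling r

hasOnes-zeroLabeling : ∀ t → HasOnes (expVec t (zeroLabeling t)) 0 0
hasOnes-zeroLabeling leaf       = ones refl refl
hasOnes-zeroLabeling (node l r) =
  hasOnes-⊕ (hasOnes-⊕ (hasOnes-edgeVec-false _) (hasOnes-edgeVec-false _))
            (hasOnes-⊕ (hasOnes-zeroLabeling l) (hasOnes-zeroLabeling r))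

Balanced : V4 → Set
Balanced x = ∃₂ λ m n → HasOnes x m n × 2 ∣ m + n

balanced-⊕ : ∀ {x y} → Balanced x → Balanced y → Balanced (x ⊕ y)
balanced-⊕ (m , n , h , 2∣m+n) (m′ , n′ , h′ , 2∣m′+n′) =
  m + m′ , n + n′ , hasOnes-⊕ h h′ ,
  subst (2 ∣_) (sym (interchange m m′ n n′)) (∣m∣n⇒∣m+n 2∣m+n 2∣m′+n′)
  where open CommutativeSemigroupProperties +-commutativeSemigroup using (interchange)

balanced-⊖ : ∀ {x y} → Balanced x → HasOnes y 0 0 → Balanced (x ⊖ y)
balanced-⊖ (m , n , h , 2∣m+n) h′ = m , n , hasOnes-⊖ h h′ , 2∣m+n

balanced-edgePair : ∀ b c d → Balanced (edgeVec b c ⊕ edgeVec b d)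
balanced-edgePair false c     d     =
  0 , 0 , hasOnes-⊕ (hasOnes-edgeVec-false c) (hasOnes-edgeVec-false d) , 2 ∣0
balanced-edgePair true  false false = 2 , 0 , ones refl refl , divides 1 refl
balanced-edgePair true  false true  = 1 , 1 , ones refl refl , divides 1 refl
balanced-edgePair true  true  false = 1 , 1 , ones refl refl , divides 1 refl
balanced-edgePair true  true  true  = 0 , 2 , ones refl refl , divides 1 refl

balanced-expVec : ∀ t j → Balanced (expVec t j)
balanced-expVec leaf       _            = 0 , 0 , ones refl refl , 2 ∣0
balanced-expVec (node l r) (b , jl , jr) =
  balanced-⊕ (balanced-edgePair b _ _) (balanced-⊕ (balanced-expVec l jl) (balanced-expVec r jr))

balanced-chart : ∀ t {x} → InChartSemigroup t (zeroLabeling t) x → Balanced x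
balanced-chart t sg-zero      = 0 , 0 , ones refl refl , 2 ∣0
balanced-chart t (sg-add j s) =
  balanced-⊕ (balanced-⊖ (balanced-expVec t j) (hasOnes-zeroLabeling t)) (balanced-chart t s)

record CherryRelation (t : BTree) : Set where
  field
    A B C    : Labeling t
    rootA    : rootLabel t A ≡ rootLabel t C
    rootB    : rootLabel t B ≡ rootLabel t C
    midpoint : expVec t A ⊕ expVec t B ≡ expVec t C ⊕ expVec t C
    onesA    : HasOnes (expVec t A) 2 0
    onesC    : HasOnes (expVec t C) 1 1

cherry : CherryRelation (node leaf leaf)
cherry = record
  { A = true , false , false
  ; B = true , true , true
  ; C = true , true , false
  ; rootA = refl
  ; rootB = refl
  ; midpoint = refl
  ; onesA = ones refl refl
  ; onesC = ones refl refl
  }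

record Grafting (s t : BTree) : Set where
  field
    graft           : Labeling s → Labeling t
    root            : Bool
    rootLabel-graft : ∀ j → rootLabel t (graft j) ≡ root
    offset          : Bool → V4
    hasOnes-offset  : ∀ c → HasOnes (offset c) 0 0
    expVec-graft    : ∀ j → expVec t (graft j) ≡ offset (rootLabel s j) ⊕ expVec s j

graftLeft : ∀ l r → Grafting l (node l r)
graftLeft l r = record
  { graft = λ j → false , j , zeroLabeling r
  ; root = false
  ; rootLabel-graft = λ _ → refl
  ; offset = λ c → (edgeVec false c ⊕ edgeVec false (rootLabel r o)) ⊕ expVec r o
  ; hasOnes-offset = λ c →
      hasOnes-⊕ (hasOnes-⊕ (hasOnes-edgeVec-false c) (hasOnes-edgeVec-false _)) (hasOnes-zeroLabeling r)
  ; expVec-graft = λ j → x∙yz≈xz∙y _ (expVec l j) _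
  }
  where
  o : Labeling r
  o = zeroLabeling r

graftRight : ∀ l r → Grafting r (node l r)
graftRight l r = record
  { graft = λ j → false , zeroLabeling l , j
  ; root = false
  ; rootLabel-graft = λ _ → refl
  ; offset = λ c → (edgeVec false (rootLabel l o) ⊕ edgeVec false c) ⊕ expVec l o
  ; hasOnes-offset = λ c →
      hasOnes-⊕ (hasOnes-⊕ (hasOnes-edgeVec-false _) (hasOnes-edgeVec-false c)) (hasOnes-zeroLabeling l)
  ; expVec-graft = λ j → sym (⊕-assoc _ _ (expVec r j))
  }
  where
  o : Labeling l
  o = zeroLabeling l

cherryRelation-graft : ∀ {s t} → Grafting s t → CherryRelation s → CherryRelation t
cherryRelation-graft {s} {t} γ κ = record
  { A = graft A
  ; B = graft B
  ; C = graft C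
  ; rootA = trans (rootLabel-graft A) (sym (rootLabel-graft C))
  ; rootB = trans (rootLabel-graft B) (sym (rootLabel-graft C))
  ; midpoint = midpoint′
  ; onesA = grafted-ones A onesA
  ; onesC = grafted-ones C onesC
  }
  where
  open Grafting γ
  open CherryRelation κ

  grafted-ones : ∀ {m n} j → HasOnes (expVec s j) m n → HasOnes (expVec t (graft j)) m n
  grafted-ones j h =
    subst (λ x → HasOnes x _ _) (sym (expVec-graft j)) (hasOnes-⊕ (hasOnes-offset _) h)

  midpoint′ : expVec t (graft A) ⊕ expVec t (graft B) ≡ expVec t (graft C) ⊕ expVec t (graft C)
  midpoint′ rewrite expVec-graft A | expVec-graft B | expVec-graft C | rootA | rootB =
    midpoint-∙ commutativeSemigroup refl midpoint

cherryRelation : ∀ l r → CherryRelation (node l r)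
cherryRelation leaf         leaf         = cherry
cherryRelation (node ll lr) r            =
  cherryRelation-graft (graftLeft (node ll lr) r) (cherryRelation ll lr)
cherryRelation leaf         (node rl rr) =
  cherryRelation-graft (graftRight leaf (node rl rr)) (cherryRelation rl rr)

m≤1∧n≤1∧m+n≡2⇒m≡1 : ∀ {m n} → m ≤ 1 → n ≤ 1 → m + n ≡ 2 → m ≡ 1
m≤1∧n≤1∧m+n≡2⇒m≡1 z≤n       z≤n       ()
m≤1∧n≤1∧m+n≡2⇒m≡1 z≤n       (s≤s z≤n) ()
m≤1∧n≤1∧m+n≡2⇒m≡1 (s≤s z≤n) _         _  = refl

¬balanced-refinement : ∀ {x y w} (ρ : Refinement _⊕_ x y w w) → Refinement.All ρ Balanced →
                       HasOnes x 2 0 → HasOnes w 1 1 → ⊥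
¬balanced-refinement (refinement _ x₀₁ _ x₁₁ refl _ refl w≡x₀₁⊕x₁₁)
  ( (m₀₀ , n₀₀ , h₀₀ , 2∣m₀₀+n₀₀) , (m₀₁ , n₀₁ , h₀₁ , _)
  , (m₁₀ , _ , h₁₀ , _) , (m₁₁ , _ , h₁₁ , _))
  onesX onesW = 2≢1 (∣1⇒≡1 (subst (2 ∣_) (cong₂ _+_ m₀₀≡1 n₀₀≡0) 2∣m₀₀+n₀₀))
  where
  x-split : m₀₀ + m₀₁ ≡ 2 × n₀₀ + n₀₁ ≡ 0
  x-split = hasOnes-unique (hasOnes-⊕ h₀₀ h₀₁) onesX

  m₀₀≤1 : m₀₀ ≤ 1
  m₀₀≤1 = subst (m₀₀ ≤_) (proj₁ (hasOnes-unique (hasOnes-⊕ h₀₀ h₁₀) onesW)) (m≤m+n m₀₀ m₁₀)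

  onesW′ : HasOnes (x₀₁ ⊕ x₁₁) 1 1
  onesW′ = subst (λ w → HasOnes w 1 1) w≡x₀₁⊕x₁₁ onesW

  m₀₁≤1 : m₀₁ ≤ 1
  m₀₁≤1 = subst (m₀₁ ≤_) (proj₁ (hasOnes-unique (hasOnes-⊕ h₀₁ h₁₁) onesW′)) (m≤m+n m₀₁ m₁₁)

  m₀₀≡1 : m₀₀ ≡ 1
  m₀₀≡1 = m≤1∧n≤1∧m+n≡2⇒m≡1 m₀₀≤1 m₀₁≤1 (proj₁ x-split)

  n₀₀≡0 : n₀₀ ≡ 0
  n₀₀≡0 = m+n≡0⇒m≡0 n₀₀ (proj₂ x-split)

  2≢1 : 2 ≢ 1
  2≢1 ()

module _ {t : BTree} (κ : CherryRelation t) where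
  open CherryRelation κ

  cherryRelation⇒¬smoothChart : ¬ SmoothChart t (zeroLabeling t)
  cherryRelation⇒¬smoothChart (_ , iso)
    with chart-refinement iso (generator t o A) (generator t o B) (generator t o C)
                              (generator t o C) (midpoint-⊖ (expVec t o) midpoint)
    where
    o : Labeling t
    o = zeroLabeling t
  ... | ρ , parts =
    ¬balanced-refinement ρ (Refinement.all-map ρ {Q = Balanced} (balanced-chart t) parts)
      (hasOnes-⊖ onesA (hasOnes-zeroLabeling t)) (hasOnes-⊖ onesC (hasOnes-zeroLabeling t))

proposition1 : (l r : BTree) → ¬ SmoothY (node l r)
proposition1 l r smooth =
  cherryRelation⇒¬smoothChart (cherryRelation l r) (smooth (zeroLabeling (node l r)))
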